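{- Let $H$ be a graph and let $Y$ be a minimal blocking set of $H$. There exists a graph $H'$ such that (i) $H'$ has a minimal blocking set of size $2|Y|-1$, and (ii) for every robust graph class $\mathcal{C}$, $\mathrm{ed}_{\mathcal{C}}(H')\le\mathrm{ed}_{\mathcal{C}}(H)+1$.
   Context: All graphs are finite, simple and undirected. A set $Y\subseteq V(G)$ is a blocking set of $G$ if no minimum vertex cover of $G$ contains $Y$; minimal if no proper subset of $Y$ is a blocking set. A graph class is robust if it is closed under disjoint union and under removal of connected components. Elimination distance: $\mathrm{ed}_{\mathcal{C}}(G)=0$ if $G\in\mathcal{C}$; $\min_{v}\mathrm{ed}_{\mathcal{C}}(G-v)+1$ if $G\notin\mathcal{C}$ is connected; the maximum of $\mathrm{ed}_{\mathcal{C}}$ over the connected components of $G$ otherwise. -}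

module Defs where

open import Data.Nat using (ℕ; zero; suc; _+_; _≤_)
open import Data.Bool using (Bool; true; false)
open import Data.Fin using (Fin; splitAt)
open import Data.Fin.Subset using (Subset; _∈_; _∉_; _⊆_; _⊂_; ∣_∣; ⁅_⁆; ∁; Nonempty)
open import Data.Sum using (_⊎_; inj₁; inj₂)
open import Data.Product using (Σ; ∃; _×_; _,_)
open import Data.Empty using (⊥)
open import Relation.Nullary using (¬_)
open import Relation.Binary.PropositionalEquality using (_≡_; refl; sym; trans)
open import Function.Bundles using (_↔_; Inverse)

record Graph : Set where
  field
    n   : ℕ
    adj : Fin n → Fin n → Bool
    adj-sym : ∀ u v → adj u v ≡ adj v u
    adj-irr : ∀ u → adj u u ≡ false
open Graph public

V : Graph → Set
V G = Fin (n G)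

Edge : (G : Graph) → V G → V G → Set
Edge G u v = adj G u v ≡ true

VertexCover : (G : Graph) → Subset (n G) → Set
VertexCover G X = ∀ u v → Edge G u v → u ∈ X ⊎ v ∈ X

MinimumVertexCover : (G : Graph) → Subset (n G) → Set
MinimumVertexCover G X =
  VertexCover G X × (∀ X′ → VertexCover G X′ → ∣ X ∣ ≤ ∣ X′ ∣)

Blocking : (G : Graph) → Subset (n G) → Set
Blocking G Y = ∀ X → MinimumVertexCover G X → ¬ (Y ⊆ X)

MinimalBlocking : (G : Graph) → Subset (n G) → Set
MinimalBlocking G Y = Blocking G Y × (∀ Y′ → Y′ ⊂ Y → ¬ Blocking G Y′)

record Iso (G H : Graph) : Set where
  field
    bij : V G ↔ V H
    preserves : ∀ u v → adj H (Inverse.to bij u) (Inverse.to bij v) ≡ adj G u v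

-- H is (a copy of) the subgraph of G induced by the vertex set S,
-- witnessed by the embedding e whose image is exactly S.
record InducedOn (G : Graph) (S : Subset (n G)) (H : Graph) : Set where
  field
    emb      : V H → V G
    emb-inj  : ∀ u v → emb u ≡ emb v → u ≡ v
    emb-in   : ∀ u → emb u ∈ S
    emb-onto : ∀ x → x ∈ S → ∃ λ u → emb u ≡ x
    emb-adj  : ∀ u v → adj H u v ≡ adj G (emb u) (emb v)

VertexDeleted : (G : Graph) → V G → Graph → Set
VertexDeleted G v H = InducedOn G (∁ ⁅ v ⁆) H

⊕-adj : ∀ {a b} → (Fin a → Fin a → Bool) → (Fin b → Fin b → Bool) →
        Fin (a + b) → Fin (a + b) → Bool
⊕-adj {a} A B i j with splitAt a i | splitAt a j
... | inj₁ x | inj₁ y = A x y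
... | inj₂ x | inj₂ y = B x y
... | inj₁ _ | inj₂ _ = false
... | inj₂ _ | inj₁ _ = false

⊕-sym : ∀ (G H : Graph) i j →
        ⊕-adj (adj G) (adj H) i j ≡ ⊕-adj (adj G) (adj H) j i
⊕-sym G H i j with splitAt (n G) i | splitAt (n G) j
... | inj₁ x | inj₁ y = adj-sym G x y
... | inj₂ x | inj₂ y = adj-sym H x y
... | inj₁ _ | inj₂ _ = refl
... | inj₂ _ | inj₁ _ = refl

⊕-irr : ∀ (G H : Graph) i → ⊕-adj (adj G) (adj H) i i ≡ false
⊕-irr G H i with splitAt (n G) i
... | inj₁ x = adj-irr G x
... | inj₂ x = adj-irr H x

_⊕_ : Graph → Graph → Graph
G ⊕ H = record
  { n = n G + n H
  ; adj = ⊕-adj (adj G) (adj H)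
  ; adj-sym = ⊕-sym G H
  ; adj-irr = ⊕-irr G H
  }

data Reachable (G : Graph) : V G → V G → Set where
  here : ∀ {u} → Reachable G u u
  step : ∀ {u v w} → Edge G u v → Reachable G v w → Reachable G u w

-- connected graphs are nonempty
Connected : Graph → Set
Connected G = V G × (∀ u v → Reachable G u v)

Component : (G : Graph) → Subset (n G) → Set
Component G S =
  Nonempty S ×
  (∀ u v → u ∈ S → Edge G u v → v ∈ S) ×
  (∀ u v → u ∈ S → v ∈ S → Reachable G u v)

GraphClass : Set₁
GraphClass = Graph → Set

IsoClosed : GraphClass → Set
IsoClosed 𝒞 = ∀ G H → Iso G H → 𝒞 G → 𝒞 H

Robust : GraphClass → Set
Robust 𝒞 =
  (∀ G H → 𝒞 G → 𝒞 H → 𝒞 (G ⊕ H)) ×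
  (∀ G S H → 𝒞 G → Component G S → InducedOn G (∁ S) H → 𝒞 H)

-- Elimination distance:  EdLe 𝒞 k G  means  ed_𝒞(G) ≤ k.
-- The three constructors follow the three clauses of the recursive
-- definition (ed = 0 on 𝒞; min over deleted vertex + 1 for connected
-- graphs; max over components otherwise).

data EdLe (𝒞 : GraphClass) : ℕ → Graph → Set where
  ed-in   : ∀ {k G} → 𝒞 G → EdLe 𝒞 k G
  ed-conn : ∀ {k G} → Connected G → (v : V G) →
            (∀ H → VertexDeleted G v H → EdLe 𝒞 k H) →
            EdLe 𝒞 (suc k) G
  ed-disc : ∀ {k G} → ¬ Connected G →
            (∀ S H → Component G S → InducedOn G S H → EdLe 𝒞 k H) →
            EdLe 𝒞 k G

-- Y is nonempty (∅ lies in every minimum cover); fix y₀ ∈ Y.  H′ is two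
-- disjoint copies of H plus an apex adjacent to Y in the first copy and to
-- y₀ in the second, and Y′ is Y in the first copy with Y - y₀ in the second.
-- If c is the vertex cover number of H, covers of H′ have at least 2c + 1
-- vertices (Y is blocking), covers containing Y′ at least 2c + 2, and for
-- each x ∈ Y′ minimality of Y gives a cover of size 2c + 1 containing Y′ - x.
--
-- For the elimination distance we introduce closed embeddings (isomorphisms
-- onto a union of components) and show by induction on the derivation that
-- ed_𝒞 does not increase along them; the base case uses that a class closed
-- under isomorphism and component removal contains the closed subgraphs of
-- its members.  Disjoint unions and apices then follow by looking at the
-- connected closed subgraphs.
module Submission where

open import Defs
open import Data.Nat using (ℕ; zero; suc; _+_; _*_; _∸_; _≤_; _<_; s≤s; _≤?_; _<?_)
open import Data.Nat.Properties
  using ( ≤-refl; ≤-reflexive; ≤-trans; ≤-antisym; ≤-pred; <-≤-trans; n≮0; m≤n+m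
        ; +-identityʳ; +-suc; +-monoˡ-≤; +-mono-≤; n≤1+n; ≮⇒≥; 1+n≰n)
open import Data.Bool using (Bool; true; false)
import Data.Bool.Properties as Bool
open import Data.Vec using ([]; _∷_; _++_; lookup)
import Data.Vec as Vec
open import Data.Vec.Properties using ([]=⇒lookup; lookup⇒[]=; lookup-++ˡ; lookup-++ʳ)
open import Data.Vec.Base using (here; there)
open import Data.Fin using (Fin; splitAt; join; _↑ˡ_; _↑ʳ_) renaming (zero to fz; suc to fs)
import Data.Fin.Properties as Fin
open import Data.Fin.Subset
  using (Subset; _∈_; _∉_; _⊆_; _⊂_; ∣_∣; ⁅_⁆; ∁; ⊤; ⊥; _∪_; _-_; outside)
open import Data.Fin.Subset.Properties
  using ( _∈?_; _⊆?_; nonempty?; anySubset?; drop-there; ∣p∣≤∣x∷p∣; ∈⊤; ∉⊥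
        ; x∈⁅x⁆; x∈⁅y⁆⇒x≡y; x≢y⇒x∉⁅y⁆
        ; x∉p⇒x∈∁p; x∈∁p⇒x∉p; x∈p⇒x∉∁p; p⊂q⇒∣p∣<∣q∣; ∣⊤∣≡n; ∣p∣≤n; ∣p∣≡n⇒p≡⊤
        ; p⊆p∪q; x∈p∪q⁺; x∈p∪q⁻; p─⊥≡p; ∪-identityʳ; p─q⊆p; x∈p∧x≢y⇒x∈p-y)
open import Data.Sum using (_⊎_; inj₁; inj₂; [_,_]′)
import Data.Sum
open import Data.Product using (Σ; ∃; _×_; _,_; proj₁; proj₂)
open import Data.Unit using (tt)
open import Data.Empty using (⊥-elim)
open import Relation.Nullary using (¬_; Dec; yes; no)
open import Relation.Nullary.Decidable using (_×-dec_; _⊎-dec_; _→-dec_; ¬?)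
open import Relation.Binary.PropositionalEquality
  using (_≡_; _≢_; refl; sym; trans; cong; cong₂; subst; module ≡-Reasoning)
open import Function.Bundles using (mk↔ₛ′)

edge-sym : (G : Graph) {u v : V G} → Edge G u v → Edge G v u
edge-sym G {u} {v} e = trans (adj-sym G v u) e

reach-snoc : {G : Graph} {u v w : V G} → Reachable G u v → Edge G v w → Reachable G u w
reach-snoc here e = step e here
reach-snoc (step e′ r) e = step e′ (reach-snoc r e)

reach-trans : {G : Graph} {u v w : V G} → Reachable G u v → Reachable G v w → Reachable G u w
reach-trans here q = q
reach-trans (step e r) q = step e (reach-trans r q)

reach-sym : {G : Graph} {u v : V G} → Reachable G u v → Reachable G v u
reach-sym here = here
reach-sym {G} (step e r) = reach-snoc (reach-sym r) (edge-sym G e)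

Closed : (G : Graph) → Subset (n G) → Set
Closed G R = ∀ u v → u ∈ R → Edge G u v → v ∈ R

closed-reach : (G : Graph) {R : Subset (n G)} → Closed G R →
               {u v : V G} → u ∈ R → Reachable G u v → v ∈ R
closed-reach G cl u∈R here = u∈R
closed-reach G cl u∈R (step e r) = closed-reach G cl (cl _ _ u∈R e) r

edge? : (G : Graph) (u v : V G) → Dec (Edge G u v)
edge? G u v = adj G u v Bool.≟ true

leaving-or-closed : (G : Graph) (R : Subset (n G)) →
  (∃ λ u → ∃ λ v → u ∈ R × Edge G u v × v ∉ R) ⊎ Closed G R
leaving-or-closed G R
  with Fin.any? (λ u → Fin.any? λ v → (u ∈? R) ×-dec (edge? G u v ×-dec ¬? (v ∈? R)))
... | yes (u , v , u∈R , e , v∉R) = inj₁ (u , v , u∈R , e , v∉R)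
... | no none = inj₂ closed
  where
  closed : Closed G R
  closed u v u∈R e with v ∈? R
  ... | yes v∈R = v∈R
  ... | no v∉R = ⊥-elim (none (u , v , u∈R , e , v∉R))

ReachClosure : (G : Graph) → V G → Set
ReachClosure G x =
  Σ (Subset (n G)) λ R → x ∈ R × (∀ v → v ∈ R → Reachable G x v) × Closed G R

-- Grow R along leaving edges until it is closed; the fuel bounds the
-- number of vertices that can still be added.
grow : (G : Graph) (x : V G) (fuel : ℕ) (R : Subset (n G)) → x ∈ R →
       (∀ v → v ∈ R → Reachable G x v) → n G ≤ ∣ R ∣ + fuel → ReachClosure G x
grow G x fuel R x∈R reach bound with leaving-or-closed G R
... | inj₂ closed = R , x∈R , reach , closed
grow G x zero R x∈R reach bound | inj₁ (_ , v , _ , _ , v∉R) = ⊥-elim (v∉R v∈R)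
  where
  R-full : ∣ R ∣ ≡ n G
  R-full = ≤-antisym (∣p∣≤n R) (subst (n G ≤_) (+-identityʳ ∣ R ∣) bound)
  v∈R : v ∈ R
  v∈R = subst (v ∈_) (sym (∣p∣≡n⇒p≡⊤ R-full)) ∈⊤
grow G x (suc fuel) R x∈R reach bound | inj₁ (u , v , u∈R , e , v∉R) =
  grow G x fuel (R ∪ ⁅ v ⁆) (p⊆p∪q ⁅ v ⁆ x∈R) reach′ bound′
  where
  reach′ : ∀ w → w ∈ R ∪ ⁅ v ⁆ → Reachable G x w
  reach′ w w∈ with x∈p∪q⁻ R ⁅ v ⁆ w∈
  ... | inj₁ w∈R = reach w w∈R
  ... | inj₂ w∈⁅v⁆ rewrite x∈⁅y⁆⇒x≡y v w∈⁅v⁆ = reach-snoc (reach u u∈R) e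
  grows : ∣ R ∣ < ∣ R ∪ ⁅ v ⁆ ∣
  grows = p⊂q⇒∣p∣<∣q∣ (p⊆p∪q ⁅ v ⁆ , v , x∈p∪q⁺ (inj₂ (x∈⁅x⁆ v)) , v∉R)
  bound′ : n G ≤ ∣ R ∪ ⁅ v ⁆ ∣ + fuel
  bound′ = ≤-trans bound (subst (_≤ ∣ R ∪ ⁅ v ⁆ ∣ + fuel) (sym (+-suc ∣ R ∣ fuel))
                                (+-monoˡ-≤ fuel grows))

singleton-reachable : (G : Graph) (x : V G) → ∀ v → v ∈ ⁅ x ⁆ → Reachable G x v
singleton-reachable G x v v∈ rewrite x∈⁅y⁆⇒x≡y x v∈ = here

componentOf : (G : Graph) (x : V G) → Σ (Subset (n G)) λ S → x ∈ S × Component G S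
componentOf G x
  with grow G x (n G) ⁅ x ⁆ (x∈⁅x⁆ x) (singleton-reachable G x) (m≤n+m (n G) ∣ ⁅ x ⁆ ∣)
... | S , x∈S , reach , closed =
  S , x∈S , (x , x∈S) , closed , λ u v u∈S v∈S → reach-trans (reach-sym (reach u u∈S)) (reach v v∈S)

reach? : (G : Graph) (x y : V G) → Dec (Reachable G x y)
reach? G x y with componentOf G x
... | S , x∈S , _ , closed , linked with y ∈? S
...   | yes y∈S = yes (linked x y x∈S y∈S)
...   | no y∉S = no (λ r → y∉S (closed-reach G closed x∈S r))

connected? : (G : Graph) → Dec (Connected G)
connected? G with Fin.any? {n = n G} (λ _ → yes tt)
... | no empty = no (λ c → empty (proj₁ c , tt))
... | yes (v , _) with Fin.all? (λ u → Fin.all? (λ w → reach? G u w))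
...   | yes linked = yes (v , linked)
...   | no unlinked = no (λ c → unlinked (proj₂ c))

select : ∀ {N} (S : Subset N) → Fin ∣ S ∣ → Fin N
select (true ∷ S) fz = fz
select (true ∷ S) (fs i) = fs (select S i)
select (false ∷ S) i = fs (select S i)

select-∈ : ∀ {N} (S : Subset N) (i : Fin ∣ S ∣) → select S i ∈ S
select-∈ (true ∷ S) fz = here
select-∈ (true ∷ S) (fs i) = there (select-∈ S i)
select-∈ (false ∷ S) i = there (select-∈ S i)

select-inj : ∀ {N} (S : Subset N) (i j : Fin ∣ S ∣) → select S i ≡ select S j → i ≡ j
select-inj (true ∷ S) fz fz eq = refl
select-inj (true ∷ S) (fs i) (fs j) eq = cong fs (select-inj S i j (Fin.suc-injective eq))
select-inj (false ∷ S) i j eq = select-inj S i j (Fin.suc-injective eq)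

select-onto : ∀ {N} (S : Subset N) (x : Fin N) → x ∈ S → ∃ λ i → select S i ≡ x
select-onto (true ∷ S) fz _ = fz , refl
select-onto (true ∷ S) (fs x) x∈ with select-onto S x (drop-there x∈)
... | i , eq = fs i , cong fs eq
select-onto (false ∷ S) (fs x) x∈ with select-onto S x (drop-there x∈)
... | i , eq = i , cong fs eq

induced : (G : Graph) (S : Subset (n G)) → Σ Graph λ K → InducedOn G S K
induced G S = K , record
  { emb = select S ; emb-inj = select-inj S ; emb-in = select-∈ S
  ; emb-onto = select-onto S ; emb-adj = λ u v → refl }
  where
  K : Graph
  K = record { n = ∣ S ∣ ; adj = λ i j → adj G (select S i) (select S j)
             ; adj-sym = λ i j → adj-sym G (select S i) (select S j)
             ; adj-irr = λ i → adj-irr G (select S i) }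

whole : (G : Graph) → InducedOn G ⊤ G
whole G = record { emb = λ u → u ; emb-inj = λ _ _ eq → eq ; emb-in = λ _ → ∈⊤
                 ; emb-onto = λ x _ → x , refl ; emb-adj = λ _ _ → refl }

∈∁⁅⁆ : ∀ {N} {x y : Fin N} → x ≢ y → x ∈ ∁ ⁅ y ⁆
∈∁⁅⁆ x≢y = x∉p⇒x∈∁p (x≢y⇒x∉⁅y⁆ x≢y)

∈∁⁅⁆⇒≢ : ∀ {N} {x y : Fin N} → x ∈ ∁ ⁅ y ⁆ → x ≢ y
∈∁⁅⁆⇒≢ {y = y} x∈ refl = x∈∁p⇒x∉p x∈ (x∈⁅x⁆ y)

-- A closed embedding maps K isomorphically onto a union of components of G.
record ClosedEmbedding (K G : Graph) : Set where
  field
    cmap        : V K → V G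
    cmap-inj    : ∀ x y → cmap x ≡ cmap y → x ≡ y
    cmap-adj    : ∀ x y → adj K x y ≡ adj G (cmap x) (cmap y)
    cmap-closed : ∀ x v → Edge G (cmap x) v → ∃ λ y → cmap y ≡ v
open ClosedEmbedding public

cmap-edge : ∀ {K G} (e : ClosedEmbedding K G) {x y} → Edge K x y → Edge G (cmap e x) (cmap e y)
cmap-edge e {x} {y} xy = trans (sym (cmap-adj e x y)) xy

cmap-path : ∀ {K G} (e : ClosedEmbedding K G) {x y} →
            Reachable K x y → Reachable G (cmap e x) (cmap e y)
cmap-path e here = here
cmap-path e (step xy r) = step (cmap-edge e xy) (cmap-path e r)

lift-path : ∀ {K G} (e : ClosedEmbedding K G) {x v} →
            Reachable G (cmap e x) v → ∃ λ y → cmap e y ≡ v × Reachable K x y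
lift-path e {x} here = x , refl , here
lift-path {K} {G} e {x} (step {v = w} xw r) with cmap-closed e x w xw
... | x′ , refl with lift-path e r
...   | y , ey , r′ = y , ey , step (trans (cmap-adj e x x′) xw) r′

compose : ∀ {J K G} → ClosedEmbedding K G → ClosedEmbedding J K → ClosedEmbedding J G
compose {J} {K} {G} e d = record
  { cmap = λ x → cmap e (cmap d x)
  ; cmap-inj = λ x y eq → cmap-inj d x y (cmap-inj e _ _ eq)
  ; cmap-adj = λ x y → trans (cmap-adj d x y) (cmap-adj e _ _)
  ; cmap-closed = closed }
  where
  closed : ∀ x v → Edge G (cmap e (cmap d x)) v → ∃ λ y → cmap e (cmap d y) ≡ v
  closed x v xv with cmap-closed e (cmap d x) v xv
  ... | z , refl with cmap-closed d x z (trans (cmap-adj e (cmap d x) z) xv)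
  ...   | y , refl = y , refl

identity : (G : Graph) → ClosedEmbedding G G
identity G = record { cmap = λ x → x ; cmap-inj = λ _ _ eq → eq
                    ; cmap-adj = λ _ _ → refl ; cmap-closed = λ _ v _ → v , refl }

component-embedding : ∀ {G S K} → Component G S → InducedOn G S K → ClosedEmbedding K G
component-embedding {G} {S} {K} (_ , closed , _) ind = record
  { cmap = emb ; cmap-inj = emb-inj ; cmap-adj = emb-adj
  ; cmap-closed = λ x v xv → emb-onto v (closed _ v (emb-in x) xv) }
  where open InducedOn ind

component-connected : ∀ {G S K} → Component G S → InducedOn G S K → Connected K
component-connected {G} {S} {K} comp@((x , x∈S) , _ , linked) ind =
  proj₁ (emb-onto x x∈S) , connect
  where
  open InducedOn ind
  connect : ∀ a b → Reachable K a b
  connect a b with lift-path (component-embedding comp ind) (linked _ _ (emb-in a) (emb-in b))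
  ... | b′ , eb , r = subst (Reachable K a) (emb-inj b′ b eb) r

connected-image : ∀ {K G} {S : Subset (n G)} → Connected K → (e : ClosedEmbedding K G) →
                  Closed G S → ∀ x → cmap e x ∈ S → ∀ y → cmap e y ∈ S
connected-image {G = G} (_ , linked) e closed x x∈S y =
  closed-reach G closed x∈S (cmap-path e (linked x y))

restrict : ∀ {K G T T′ K′ G′} (e : ClosedEmbedding K G) →
           InducedOn K T K′ → InducedOn G T′ G′ →
           (∀ x → x ∈ T → cmap e x ∈ T′) → (∀ x → cmap e x ∈ T′ → x ∈ T) →
           ClosedEmbedding K′ G′
restrict {K} {G} {T} {T′} {K′} {G′} e iK iG to-T′ to-T = record
  { cmap = λ x → proj₁ (image x)
  ; cmap-inj = λ x y eq → IK.emb-inj x y (cmap-inj e _ _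
                 (trans (sym (proj₂ (image x))) (trans (cong IG.emb eq) (proj₂ (image y)))))
  ; cmap-adj = adjacency
  ; cmap-closed = closed }
  where
  module IK = InducedOn iK
  module IG = InducedOn iG
  image : ∀ x → ∃ λ a → IG.emb a ≡ cmap e (IK.emb x)
  image x = IG.emb-onto _ (to-T′ _ (IK.emb-in x))
  adjacency : ∀ x y → adj K′ x y ≡ adj G′ (proj₁ (image x)) (proj₁ (image y))
  adjacency x y = begin
    adj K′ x y
      ≡⟨ IK.emb-adj x y ⟩
    adj K (IK.emb x) (IK.emb y)
      ≡⟨ cmap-adj e _ _ ⟩
    adj G (cmap e (IK.emb x)) (cmap e (IK.emb y))
      ≡⟨ cong₂ (adj G) (proj₂ (image x)) (proj₂ (image y)) ⟨
    adj G (IG.emb (proj₁ (image x))) (IG.emb (proj₁ (image y)))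
      ≡⟨ IG.emb-adj _ _ ⟨
    adj G′ (proj₁ (image x)) (proj₁ (image y))
      ∎
    where open ≡-Reasoning
  closed : ∀ x w → Edge G′ (proj₁ (image x)) w → ∃ λ y → proj₁ (image y) ≡ w
  closed x w xw with cmap-closed e (IK.emb x) (IG.emb w)
                       (trans (cong (λ z → adj G z (IG.emb w)) (sym (proj₂ (image x))))
                              (trans (sym (IG.emb-adj _ w)) xw))
  ... | z , ez with IK.emb-onto z (to-T z (subst (_∈ T′) (sym ez) (IG.emb-in w)))
  ...   | y , refl = y , IG.emb-inj _ w (trans (proj₂ (image y)) ez)

corestrict : ∀ {K G T G′} (e : ClosedEmbedding K G) → InducedOn G T G′ →
             (∀ x → cmap e x ∈ T) → ClosedEmbedding K G′
corestrict {K} e iG in-T = restrict e (whole K) iG (λ x _ → in-T x) (λ _ _ → ∈⊤)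

restrict-deleted : ∀ {K G K′ G′} (e : ClosedEmbedding K G) {u v} → cmap e u ≡ v →
                   VertexDeleted K u K′ → VertexDeleted G v G′ → ClosedEmbedding K′ G′
restrict-deleted e {u} eu dK dG = restrict e dK dG
  (λ x x∈ → ∈∁⁅⁆ λ ex → ∈∁⁅⁆⇒≢ x∈ (cmap-inj e x u (trans ex (sym eu))))
  (λ x x∈ → ∈∁⁅⁆ λ { refl → ∈∁⁅⁆⇒≢ x∈ eu })

surjective⇒iso : ∀ {K G} (e : ClosedEmbedding K G) → (∀ v → ∃ λ x → cmap e x ≡ v) → Iso G K
surjective⇒iso {K} {G} e onto = record
  { bij = mk↔ₛ′ preimage (cmap e) (λ x → cmap-inj e _ x (proj₂ (onto (cmap e x))))
                                  (λ v → proj₂ (onto v))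
  ; preserves = λ u v → trans (cmap-adj e _ _) (cong₂ (adj G) (proj₂ (onto u)) (proj₂ (onto v))) }
  where
  preimage : V G → V K
  preimage v = proj₁ (onto v)

ComponentRemovalClosed : GraphClass → Set
ComponentRemovalClosed 𝒞 = ∀ G S H → 𝒞 G → Component G S → InducedOn G (∁ S) H → 𝒞 H

-- Such a class (closed also under isomorphism) contains the closed subgraphs
-- of its members: remove, one at a time, the components of G that miss the
-- image of K; what remains is isomorphic to K.
closed-subgraph-in-class : (𝒞 : GraphClass) → IsoClosed 𝒞 → ComponentRemovalClosed 𝒞 →
  ∀ fuel {K G} → n G ≤ fuel → 𝒞 G → ClosedEmbedding K G → 𝒞 K
closed-subgraph-in-class 𝒞 iso removal fuel {K} {G} small G∈𝒞 e
  with Fin.all? (λ v → Fin.any? (λ x → cmap e x Fin.≟ v))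
... | yes onto = iso G K (surjective⇒iso e onto) G∈𝒞
... | no not-onto with Fin.¬∀⟶∃¬ _ _ (λ v → Fin.any? (λ x → cmap e x Fin.≟ v)) not-onto
...   | v , v-missed with componentOf G v
...     | S , v∈S , comp = recurse fuel small
  where
  G₁ : Graph
  G₁ = proj₁ (induced G (∁ S))
  ind : InducedOn G (∁ S) G₁
  ind = proj₂ (induced G (∁ S))
  image-outside : ∀ x → cmap e x ∈ ∁ S
  image-outside x = x∉p⇒x∈∁p λ x∈S →
    let (y , ey , _) = lift-path e (reach-sym (proj₂ (proj₂ comp) v _ v∈S x∈S)) in v-missed (y , ey)
  shrinks : n G₁ < n G
  shrinks = subst (∣ ∁ S ∣ <_) (∣⊤∣≡n (n G)) (p⊂q⇒∣p∣<∣q∣ ((λ _ → ∈⊤) , v , ∈⊤ , x∈p⇒x∉∁p v∈S))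
  recurse : ∀ fuel → n G ≤ fuel → 𝒞 K
  recurse zero small′ = ⊥-elim (n≮0 (<-≤-trans shrinks small′))
  recurse (suc fuel) small′ =
    closed-subgraph-in-class 𝒞 iso removal fuel (≤-pred (<-≤-trans shrinks small′))
      (removal G S G₁ G∈𝒞 comp ind) (corestrict e ind image-outside)

false≢true : false ≢ true
false≢true ()

data Side (a b : ℕ) : Fin (a + b) → Set where
  left  : (u : Fin a) → Side a b (u ↑ˡ b)
  right : (v : Fin b) → Side a b (a ↑ʳ v)

side : ∀ a b (x : Fin (a + b)) → Side a b x
side a b x = subst (Side a b) (Fin.join-splitAt a b x) (from-split (splitAt a x))
  where
  from-split : ∀ s → Side a b (join a b s)
  from-split (inj₁ u) = left u
  from-split (inj₂ v) = right v

∈-++ˡ⁺ : ∀ {a b} (p : Subset a) (q : Subset b) {u} → u ∈ p → u ↑ˡ b ∈ p ++ q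
∈-++ˡ⁺ p q {u} u∈ = lookup⇒[]= _ (p ++ q) (trans (lookup-++ˡ p q u) ([]=⇒lookup u∈))

∈-++ˡ⁻ : ∀ {a b} (p : Subset a) (q : Subset b) {u} → u ↑ˡ b ∈ p ++ q → u ∈ p
∈-++ˡ⁻ p q {u} u∈ = lookup⇒[]= u p (trans (sym (lookup-++ˡ p q u)) ([]=⇒lookup u∈))

∈-++ʳ⁺ : ∀ {a b} (p : Subset a) (q : Subset b) {v} → v ∈ q → a ↑ʳ v ∈ p ++ q
∈-++ʳ⁺ p q {v} v∈ = lookup⇒[]= _ (p ++ q) (trans (lookup-++ʳ p q v) ([]=⇒lookup v∈))

∈-++ʳ⁻ : ∀ {a b} (p : Subset a) (q : Subset b) {v} → a ↑ʳ v ∈ p ++ q → v ∈ q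
∈-++ʳ⁻ p q {v} v∈ = lookup⇒[]= v q (trans (sym (lookup-++ʳ p q v)) ([]=⇒lookup v∈))

module _ (G₁ G₂ : Graph) where

  ⊕-adj-ll : ∀ u v → adj (G₁ ⊕ G₂) (u ↑ˡ n G₂) (v ↑ˡ n G₂) ≡ adj G₁ u v
  ⊕-adj-ll u v rewrite Fin.splitAt-↑ˡ (n G₁) u (n G₂) | Fin.splitAt-↑ˡ (n G₁) v (n G₂) = refl

  ⊕-adj-rr : ∀ u v → adj (G₁ ⊕ G₂) (n G₁ ↑ʳ u) (n G₁ ↑ʳ v) ≡ adj G₂ u v
  ⊕-adj-rr u v rewrite Fin.splitAt-↑ʳ (n G₁) (n G₂) u | Fin.splitAt-↑ʳ (n G₁) (n G₂) v = refl

  ⊕-adj-lr : ∀ u v → adj (G₁ ⊕ G₂) (u ↑ˡ n G₂) (n G₁ ↑ʳ v) ≡ false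
  ⊕-adj-lr u v rewrite Fin.splitAt-↑ˡ (n G₁) u (n G₂) | Fin.splitAt-↑ʳ (n G₁) (n G₂) v = refl

  ⊕-adj-rl : ∀ u v → adj (G₁ ⊕ G₂) (n G₁ ↑ʳ u) (v ↑ˡ n G₂) ≡ false
  ⊕-adj-rl u v rewrite Fin.splitAt-↑ʳ (n G₁) (n G₂) u | Fin.splitAt-↑ˡ (n G₁) v (n G₂) = refl

  Left Right : Subset (n G₁ + n G₂)
  Left = ⊤ {n = n G₁} ++ ⊥ {n = n G₂}
  Right = ⊥ {n = n G₁} ++ ⊤ {n = n G₂}

  left-∈ : ∀ u → u ↑ˡ n G₂ ∈ Left
  left-∈ u = ∈-++ˡ⁺ ⊤ (⊥ {n = n G₂}) ∈⊤

  right-∈ : ∀ v → n G₁ ↑ʳ v ∈ Right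
  right-∈ v = ∈-++ʳ⁺ (⊥ {n = n G₁}) ⊤ ∈⊤

  right-∉ : ∀ v → n G₁ ↑ʳ v ∉ Left
  right-∉ v v∈ = ∉⊥ (∈-++ʳ⁻ (⊤ {n = n G₁}) ⊥ v∈)

  left-∉ : ∀ u → u ↑ˡ n G₂ ∉ Right
  left-∉ u u∈ = ∉⊥ (∈-++ˡ⁻ ⊥ (⊤ {n = n G₂}) u∈)

  left-induced : InducedOn (G₁ ⊕ G₂) Left G₁
  left-induced = record
    { emb = _↑ˡ n G₂ ; emb-inj = Fin.↑ˡ-injective (n G₂) ; emb-in = left-∈
    ; emb-onto = onto ; emb-adj = λ u v → sym (⊕-adj-ll u v) }
    where
    onto : ∀ x → x ∈ Left → ∃ λ u → u ↑ˡ n G₂ ≡ x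
    onto x x∈ with side (n G₁) (n G₂) x
    ... | left u = u , refl
    ... | right v = ⊥-elim (right-∉ v x∈)

  right-induced : InducedOn (G₁ ⊕ G₂) Right G₂
  right-induced = record
    { emb = n G₁ ↑ʳ_ ; emb-inj = Fin.↑ʳ-injective (n G₁) ; emb-in = right-∈
    ; emb-onto = onto ; emb-adj = λ u v → sym (⊕-adj-rr u v) }
    where
    onto : ∀ x → x ∈ Right → ∃ λ v → n G₁ ↑ʳ v ≡ x
    onto x x∈ with side (n G₁) (n G₂) x
    ... | left u = ⊥-elim (left-∉ u x∈)
    ... | right v = v , refl

  right-of-not-left : ∀ x → x ∉ Left → x ∈ Right
  right-of-not-left x x∉ with side (n G₁) (n G₂) x
  ... | left u = ⊥-elim (x∉ (left-∈ u))
  ... | right v = right-∈ v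

  left-closed : Closed (G₁ ⊕ G₂) Left
  left-closed x y x∈ xy with side (n G₁) (n G₂) x | side (n G₁) (n G₂) y
  ... | left u | left v = left-∈ v
  ... | left u | right v = ⊥-elim (false≢true (trans (sym (⊕-adj-lr u v)) xy))
  ... | right u | _ = ⊥-elim (right-∉ u x∈)

apex-adj : ∀ {N} → Subset N → (Fin N → Fin N → Bool) → Fin (suc N) → Fin (suc N) → Bool
apex-adj A E fz fz = false
apex-adj A E fz (fs j) = lookup A j
apex-adj A E (fs i) fz = lookup A i
apex-adj A E (fs i) (fs j) = E i j

Apex : (G : Graph) → Subset (n G) → Graph
Apex G A = record { n = suc (n G) ; adj = apex-adj A (adj G)
                  ; adj-sym = symmetric ; adj-irr = irreflexive }
  where
  symmetric : ∀ i j → apex-adj A (adj G) i j ≡ apex-adj A (adj G) j i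
  symmetric fz fz = refl
  symmetric fz (fs j) = refl
  symmetric (fs i) fz = refl
  symmetric (fs i) (fs j) = adj-sym G i j
  irreflexive : ∀ i → apex-adj A (adj G) i i ≡ false
  irreflexive fz = refl
  irreflexive (fs i) = adj-irr G i

apex-deleted : (G : Graph) (A : Subset (n G)) → VertexDeleted (Apex G A) fz G
apex-deleted G A = record
  { emb = fs ; emb-inj = λ _ _ → Fin.suc-injective ; emb-in = λ u → ∈∁⁅⁆ {y = fz} (λ ())
  ; emb-onto = onto ; emb-adj = λ _ _ → refl }
  where
  onto : ∀ x → x ∈ ∁ ⁅ fz ⁆ → ∃ λ u → fs u ≡ x
  onto fz x∈ = ⊥-elim (∈∁⁅⁆⇒≢ x∈ refl)
  onto (fs u) _ = u , refl

apex-edge⁻ : (G : Graph) (A : Subset (n G)) {j : V G} → Edge (Apex G A) fz (fs j) → j ∈ A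
apex-edge⁻ G A {j} e = lookup⇒[]= j A e

apex-edge⁺ : (G : Graph) (A : Subset (n G)) {j : V G} → j ∈ A → Edge (Apex G A) fz (fs j)
apex-edge⁺ G A j∈ = []=⇒lookup j∈

module EliminationDistance (𝒞 : GraphClass) (iso : IsoClosed 𝒞)
                           (removal : ComponentRemovalClosed 𝒞) where

  ed-suc : ∀ {k G} → EdLe 𝒞 k G → EdLe 𝒞 (suc k) G
  ed-suc (ed-in G∈𝒞) = ed-in G∈𝒞
  ed-suc (ed-conn c v ed-del) = ed-conn c v (λ H del → ed-suc (ed-del H del))
  ed-suc (ed-disc nc ed-comp) = ed-disc nc (λ S H comp ind → ed-suc (ed-comp S H comp ind))

  ed-by-components : ∀ {k K} →
    (∀ J → Connected J → ClosedEmbedding J K → EdLe 𝒞 k J) → EdLe 𝒞 k K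
  ed-by-components {K = K} bound with connected? K
  ... | yes c = bound K c (identity K)
  ... | no nc = ed-disc nc λ S J comp ind →
                  bound J (component-connected comp ind) (component-embedding comp ind)

  mutual
    ed-embedded : ∀ {k G K} → EdLe 𝒞 k G → ClosedEmbedding K G → EdLe 𝒞 k K
    ed-embedded d e = ed-by-components λ J c f → ed-embedded-connected d c (compose e f)

    -- Induction on the derivation for G: a connected K lies inside one
    -- component of G, and the vertex deleted from G has a preimage in K.
    ed-embedded-connected : ∀ {k G K} → EdLe 𝒞 k G → Connected K →
                            ClosedEmbedding K G → EdLe 𝒞 k K
    ed-embedded-connected {G = G} (ed-in G∈𝒞) _ e =
      ed-in (closed-subgraph-in-class 𝒞 iso removal (n G) ≤-refl G∈𝒞 e)
    ed-embedded-connected {G = G} (ed-conn (_ , linked) v ed-del) kc@(x , _) e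
      with lift-path e (linked (cmap e x) v)
    ... | u , eu , _ =
      ed-conn kc u λ K′ dK → ed-embedded (ed-del G′ dG) (restrict-deleted e eu dK dG)
      where
      G′ : Graph
      G′ = proj₁ (induced G (∁ ⁅ v ⁆))
      dG : VertexDeleted G v G′
      dG = proj₂ (induced G (∁ ⁅ v ⁆))
    ed-embedded-connected {G = G} (ed-disc _ ed-comp) kc@(x , _) e
      with componentOf G (cmap e x)
    ... | S , x∈S , comp@(_ , closed , _) =
      ed-embedded-connected (ed-comp S GS comp ind) kc
        (corestrict e ind (connected-image kc e closed x x∈S))
      where
      GS : Graph
      GS = proj₁ (induced G S)
      ind : InducedOn G S GS
      ind = proj₂ (induced G S)

  ed-⊕ : ∀ {k G₁ G₂} → EdLe 𝒞 k G₁ → EdLe 𝒞 k G₂ → EdLe 𝒞 k (G₁ ⊕ G₂)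
  ed-⊕ {k} {G₁} {G₂} d₁ d₂ = ed-by-components on-component
    where
    -- a connected closed subgraph lies entirely in one summand
    on-component : ∀ J → Connected J → ClosedEmbedding J (G₁ ⊕ G₂) → EdLe 𝒞 k J
    on-component J jc@(x , _) e with cmap e x ∈? Left G₁ G₂
    ... | yes x-left = ed-embedded d₁ (corestrict e (left-induced G₁ G₂)
                         (connected-image jc e (left-closed G₁ G₂) x x-left))
    ... | no x-right = ed-embedded d₂ (corestrict e (right-induced G₁ G₂) λ y →
                         right-of-not-left G₁ G₂ _ λ y-left →
                           x-right (connected-image jc e (left-closed G₁ G₂) y y-left x))

  ed-apex : ∀ {k G} (A : Subset (n G)) → EdLe 𝒞 k G → EdLe 𝒞 (suc k) (Apex G A)
  ed-apex {k} {G} A d = ed-by-components on-component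
    where
    -- delete the apex if the subgraph contains it
    on-component : ∀ J → Connected J → ClosedEmbedding J (Apex G A) → EdLe 𝒞 (suc k) J
    on-component J jc e with Fin.any? (λ a → cmap e a Fin.≟ fz)
    ... | yes (a , ea) =
      ed-conn jc a λ J′ dJ → ed-embedded d (restrict-deleted e ea dJ (apex-deleted G A))
    ... | no no-apex = ed-suc (ed-embedded d (corestrict e (apex-deleted G A) λ x →
                         ∈∁⁅⁆ λ ex → no-apex (x , ex)))

∣++∣ : ∀ {a b} (p : Subset a) (q : Subset b) → ∣ p ++ q ∣ ≡ ∣ p ∣ + ∣ q ∣
∣++∣ [] q = refl
∣++∣ (true ∷ p) q = cong suc (∣++∣ p q)
∣++∣ (false ∷ p) q = ∣++∣ p q

∣p-x∣ : ∀ {N} (p : Subset N) {x} → x ∈ p → suc ∣ p - x ∣ ≡ ∣ p ∣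
∣p-x∣ (true ∷ p) here = cong (λ q → suc ∣ q ∣) (p─⊥≡p p)
∣p-x∣ (true ∷ p) (there x∈p) = cong suc (∣p-x∣ p x∈p)
∣p-x∣ (false ∷ p) (there x∈p) = ∣p-x∣ p x∈p

∣p∪⁅x⁆∣ : ∀ {N} (p : Subset N) x → ∣ p ∪ ⁅ x ⁆ ∣ ≤ suc ∣ p ∣
∣p∪⁅x⁆∣ (true ∷ p) fz = s≤s (≤-trans (≤-reflexive (cong ∣_∣ (∪-identityʳ p))) (n≤1+n ∣ p ∣))
∣p∪⁅x⁆∣ (false ∷ p) fz = s≤s (≤-reflexive (cong ∣_∣ (∪-identityʳ p)))
∣p∪⁅x⁆∣ (true ∷ p) (fs x) = s≤s (∣p∪⁅x⁆∣ p x)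
∣p∪⁅x⁆∣ (false ∷ p) (fs x) = ∣p∪⁅x⁆∣ p x

∉-minus : ∀ {N} (p : Subset N) {x} → x ∉ p - x
∉-minus (b ∷ p) {fs x} (there x∈) = ∉-minus p x∈

∈-minus⇒≢ : ∀ {N} (p : Subset N) {x y} → x ∈ p - y → x ≢ y
∈-minus⇒≢ p x∈ refl = ∉-minus p x∈

cover? : (G : Graph) (X : Subset (n G)) → Dec (VertexCover G X)
cover? G X = Fin.all? λ u → Fin.all? λ v → edge? G u v →-dec ((u ∈? X) ⊎-dec (v ∈? X))

cover-⊆ : (G : Graph) {X X′ : Subset (n G)} → X ⊆ X′ → VertexCover G X → VertexCover G X′
cover-⊆ G X⊆X′ cover u v e = Data.Sum.map X⊆X′ X⊆X′ (cover u v e)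

minimum-by-bound : (G : Graph) {m : ℕ} → (∀ X′ → VertexCover G X′ → m ≤ ∣ X′ ∣) →
                   ∀ {X} → VertexCover G X → ∣ X ∣ ≤ m → MinimumVertexCover G X
minimum-by-bound G bound cover small = cover , λ X′ cover′ → ≤-trans small (bound X′ cover′)

minimum-cover : (G : Graph) → Σ (Subset (n G)) (MinimumVertexCover G)
minimum-cover G = shrink (n G) ⊤ (λ u _ _ → inj₁ ∈⊤) (∣p∣≤n ⊤)
  where
  shrink : ∀ fuel X → VertexCover G X → ∣ X ∣ ≤ fuel → Σ (Subset (n G)) (MinimumVertexCover G)
  shrink fuel X cover small with anySubset? (λ X′ → cover? G X′ ×-dec (∣ X′ ∣ <? ∣ X ∣))
  ... | no none = X , cover , λ X′ cover′ → ≮⇒≥ (λ smaller → none (X′ , cover′ , smaller))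
  shrink zero X cover small | yes (X′ , _ , smaller) = ⊥-elim (n≮0 (<-≤-trans smaller small))
  shrink (suc fuel) X cover small | yes (X′ , cover′ , smaller) =
    shrink fuel X′ cover′ (≤-pred (<-≤-trans smaller small))

unblocked-cover : (G : Graph) {X₀ : Subset (n G)} → MinimumVertexCover G X₀ →
                  ∀ Z → ¬ Blocking G Z → Σ (Subset (n G)) λ X → MinimumVertexCover G X × Z ⊆ X
unblocked-cover G {X₀} (cover₀ , least₀) Z unblocked
  with anySubset? (λ X → cover? G X ×-dec ((∣ X ∣ ≤? ∣ X₀ ∣) ×-dec (Z ⊆? X)))
... | yes (X , cover , small , Z⊆X) = X , minimum-by-bound G least₀ cover small , Z⊆X
... | no none =
  ⊥-elim (unblocked λ X (cover , least) Z⊆X → none (X , cover , least X₀ cover₀ , Z⊆X))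

blocked-cover-large : (G : Graph) {Y X₀ X : Subset (n G)} → Blocking G Y →
                      MinimumVertexCover G X₀ → VertexCover G X → Y ⊆ X → ∣ X₀ ∣ < ∣ X ∣
blocked-cover-large G {X₀ = X₀} {X} blocking (_ , least₀) cover Y⊆X with ∣ X₀ ∣ <? ∣ X ∣
... | yes larger = larger
... | no not-larger =
  ⊥-elim (blocking X (minimum-by-bound G least₀ cover (≮⇒≥ not-larger)) Y⊆X)

apex-cover⁻ : (G : Graph) (A : Subset (n G)) (b : Bool) (X : Subset (n G)) →
              VertexCover (Apex G A) (b ∷ X) → VertexCover G X × (b ≡ true ⊎ A ⊆ X)
apex-cover⁻ G A b X cover = base , apex-or-neighbours b cover
  where
  base : VertexCover G X
  base u v e = Data.Sum.map drop-there drop-there (cover (fs u) (fs v) e)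
  apex-or-neighbours : ∀ b′ → VertexCover (Apex G A) (b′ ∷ X) → b′ ≡ true ⊎ A ⊆ X
  apex-or-neighbours true _ = inj₁ refl
  apex-or-neighbours false cover′ =
    inj₂ λ j∈A → [ (λ ()) , drop-there ]′ (cover′ fz _ (apex-edge⁺ G A j∈A))

apex-cover⁺ : (G : Graph) (A : Subset (n G)) (b : Bool) (X : Subset (n G)) →
              VertexCover G X → b ≡ true ⊎ A ⊆ X → VertexCover (Apex G A) (b ∷ X)
apex-cover⁺ G A b X base apex fz fz ()
apex-cover⁺ G A b X base apex fz (fs j) e = neighbour apex
  where
  neighbour : b ≡ true ⊎ A ⊆ X → fz ∈ b ∷ X ⊎ fs j ∈ b ∷ X
  neighbour (inj₁ refl) = inj₁ here
  neighbour (inj₂ A⊆X) = inj₂ (there (A⊆X (apex-edge⁻ G A e)))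
apex-cover⁺ G A b X base apex (fs i) fz e =
  Data.Sum.swap (apex-cover⁺ G A b X base apex fz (fs i) (edge-sym (Apex G A) {fs i} {fz} e))
apex-cover⁺ G A b X base apex (fs i) (fs j) e = Data.Sum.map there there (base i j e)

⊕-cover⁻ : (G₁ G₂ : Graph) (X₁ : Subset (n G₁)) (X₂ : Subset (n G₂)) →
           VertexCover (G₁ ⊕ G₂) (X₁ ++ X₂) → VertexCover G₁ X₁ × VertexCover G₂ X₂
⊕-cover⁻ G₁ G₂ X₁ X₂ cover =
  (λ u v e → Data.Sum.map (∈-++ˡ⁻ X₁ X₂) (∈-++ˡ⁻ X₁ X₂)
               (cover _ _ (trans (⊕-adj-ll G₁ G₂ u v) e))) ,
  (λ u v e → Data.Sum.map (∈-++ʳ⁻ X₁ X₂) (∈-++ʳ⁻ X₁ X₂)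
               (cover _ _ (trans (⊕-adj-rr G₁ G₂ u v) e)))

⊕-cover⁺ : (G₁ G₂ : Graph) (X₁ : Subset (n G₁)) (X₂ : Subset (n G₂)) →
           VertexCover G₁ X₁ → VertexCover G₂ X₂ → VertexCover (G₁ ⊕ G₂) (X₁ ++ X₂)
⊕-cover⁺ G₁ G₂ X₁ X₂ cover₁ cover₂ x y e with side (n G₁) (n G₂) x | side (n G₁) (n G₂) y
... | left u | left v =
  Data.Sum.map (∈-++ˡ⁺ X₁ X₂) (∈-++ˡ⁺ X₁ X₂) (cover₁ u v (trans (sym (⊕-adj-ll G₁ G₂ u v)) e))
... | right u | right v =
  Data.Sum.map (∈-++ʳ⁺ X₁ X₂) (∈-++ʳ⁺ X₁ X₂) (cover₂ u v (trans (sym (⊕-adj-rr G₁ G₂ u v)) e))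
... | left u | right v = ⊥-elim (false≢true (trans (sym (⊕-adj-lr G₁ G₂ u v)) e))
... | right u | left v = ⊥-elim (false≢true (trans (sym (⊕-adj-rl G₁ G₂ u v)) e))

add-back : ∀ {N} {p X : Subset N} {a} → p - a ⊆ X → a ∈ X → p ⊆ X
add-back {a = a} p-a⊆X a∈X {x} x∈p with x Fin.≟ a
... | yes refl = a∈X
... | no x≢a = p-a⊆X (x∈p∧x≢y⇒x∈p-y x∈p x≢a)

module Doubling (H : Graph) (Y : Subset (n H)) (y₀ : V H) where

  H′ : Graph
  H′ = Apex (H ⊕ H) (Y ++ ⁅ y₀ ⁆)

  Y′ : Subset (n H′)
  Y′ = outside ∷ (Y ++ (Y - y₀))

  -- |Y′| = |Y| + (|Y| - 1)
  size-Y′ : y₀ ∈ Y → ∣ Y′ ∣ ≡ 2 * ∣ Y ∣ ∸ 1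
  size-Y′ y₀∈Y = begin
    ∣ Y ++ (Y - y₀) ∣            ≡⟨ ∣++∣ Y (Y - y₀) ⟩
    ∣ Y ∣ + ∣ Y - y₀ ∣           ≡⟨ cong (_+ ∣ Y - y₀ ∣) (∣p-x∣ Y y₀∈Y) ⟨
    suc ∣ Y - y₀ ∣ + ∣ Y - y₀ ∣  ≡⟨ double-pred ∣ Y - y₀ ∣ ⟩
    2 * suc ∣ Y - y₀ ∣ ∸ 1       ≡⟨ cong (λ t → 2 * t ∸ 1) (∣p-x∣ Y y₀∈Y) ⟩
    2 * ∣ Y ∣ ∸ 1                ∎
    where
    open ≡-Reasoning
    double-pred : ∀ s → suc s + s ≡ 2 * suc s ∸ 1
    double-pred s = trans (cong (λ t → suc (s + t)) (sym (+-identityʳ s))) (sym (+-suc s (s + 0)))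

  -- ed(H′) ≤ ed(H ⊕ H) + 1 ≤ ed(H) + 1.
  ed-H′ : (𝒞 : GraphClass) → IsoClosed 𝒞 → Robust 𝒞 → ∀ {k} → EdLe 𝒞 k H → EdLe 𝒞 (suc k) H′
  ed-H′ 𝒞 iso (_ , removal) d = ed-apex (Y ++ ⁅ y₀ ⁆) (ed-⊕ d d)
    where open EliminationDistance 𝒞 iso removal

  copy₁ copy₂ : V H → V H′
  copy₁ u = fs (u ↑ˡ n H)
  copy₂ u = fs (n H ↑ʳ u)

  data Vertex : V H′ → Set where
    apex   : Vertex fz
    first  : ∀ u → Vertex (copy₁ u)
    second : ∀ u → Vertex (copy₂ u)

  vertex : ∀ x → Vertex x
  vertex fz = apex
  vertex (fs j) with side (n H) (n H) j
  ... | left u = first u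
  ... | right u = second u

  data Split : Subset (n H′) → Set where
    split : ∀ b (X₁ X₂ : Subset (n H)) → Split (b ∷ (X₁ ++ X₂))

  splitting : ∀ X → Split X
  splitting (b ∷ Z) with Vec.splitAt (n H) Z
  ... | X₁ , X₂ , refl = split b X₁ X₂

  module _ {b : Bool} {X₁ X₂ : Subset (n H)} where

    ∈₁⁻ : ∀ {u} → copy₁ u ∈ b ∷ (X₁ ++ X₂) → u ∈ X₁
    ∈₁⁻ u∈ = ∈-++ˡ⁻ X₁ X₂ (drop-there u∈)

    ∈₁⁺ : ∀ {u} → u ∈ X₁ → copy₁ u ∈ b ∷ (X₁ ++ X₂)
    ∈₁⁺ u∈ = there (∈-++ˡ⁺ X₁ X₂ u∈)

    ∈₂⁻ : ∀ {u} → copy₂ u ∈ b ∷ (X₁ ++ X₂) → u ∈ X₂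
    ∈₂⁻ u∈ = ∈-++ʳ⁻ X₁ X₂ (drop-there u∈)

    ∈₂⁺ : ∀ {u} → u ∈ X₂ → copy₂ u ∈ b ∷ (X₁ ++ X₂)
    ∈₂⁺ u∈ = there (∈-++ʳ⁺ X₁ X₂ u∈)

  ∣split∣ : ∀ b (X₁ X₂ : Subset (n H)) → ∣ X₁ ∣ + ∣ X₂ ∣ ≤ ∣ b ∷ (X₁ ++ X₂) ∣
  ∣split∣ b X₁ X₂ = ≤-trans (≤-reflexive (sym (∣++∣ X₁ X₂))) (∣p∣≤∣x∷p∣ b (X₁ ++ X₂))

  module _ (b : Bool) (X₁ X₂ : Subset (n H)) where

    cover⁻ : VertexCover H′ (b ∷ (X₁ ++ X₂)) →
             VertexCover H X₁ × VertexCover H X₂ × (b ≡ true ⊎ Y ⊆ X₁ × y₀ ∈ X₂)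
    cover⁻ cover with apex-cover⁻ (H ⊕ H) (Y ++ ⁅ y₀ ⁆) b (X₁ ++ X₂) cover
    ... | base , apex-ok with ⊕-cover⁻ H H X₁ X₂ base
    ...   | cover₁ , cover₂ = cover₁ , cover₂ , Data.Sum.map₂ neighbours apex-ok
      where
      neighbours : Y ++ ⁅ y₀ ⁆ ⊆ X₁ ++ X₂ → Y ⊆ X₁ × y₀ ∈ X₂
      neighbours A⊆ = (λ u∈ → ∈-++ˡ⁻ X₁ X₂ (A⊆ (∈-++ˡ⁺ Y ⁅ y₀ ⁆ u∈))) ,
                      ∈-++ʳ⁻ X₁ X₂ (A⊆ (∈-++ʳ⁺ Y ⁅ y₀ ⁆ (x∈⁅x⁆ y₀)))

    cover⁺ : VertexCover H X₁ → VertexCover H X₂ → b ≡ true ⊎ Y ⊆ X₁ × y₀ ∈ X₂ →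
             VertexCover H′ (b ∷ (X₁ ++ X₂))
    cover⁺ cover₁ cover₂ apex-ok =
      apex-cover⁺ (H ⊕ H) (Y ++ ⁅ y₀ ⁆) b (X₁ ++ X₂) (⊕-cover⁺ H H X₁ X₂ cover₁ cover₂)
                  (Data.Sum.map₂ neighbours apex-ok)
      where
      neighbours : Y ⊆ X₁ × y₀ ∈ X₂ → Y ++ ⁅ y₀ ⁆ ⊆ X₁ ++ X₂
      neighbours (Y⊆X₁ , y₀∈X₂) {x} x∈ with side (n H) (n H) x
      ... | left u = ∈-++ˡ⁺ X₁ X₂ (Y⊆X₁ (∈-++ˡ⁻ Y ⁅ y₀ ⁆ x∈))
      ... | right u rewrite x∈⁅y⁆⇒x≡y y₀ (∈-++ʳ⁻ Y ⁅ y₀ ⁆ x∈) = ∈-++ʳ⁺ X₁ X₂ y₀∈X₂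

  module Covers (minimal-blocking : MinimalBlocking H Y) (y₀∈Y : y₀ ∈ Y) where

    X₀ : Subset (n H)
    X₀ = proj₁ (minimum-cover H)

    min₀ : MinimumVertexCover H X₀
    min₀ = proj₂ (minimum-cover H)

    c : ℕ
    c = ∣ X₀ ∣

    least : ∀ {X} → VertexCover H X → c ≤ ∣ X ∣
    least cover = proj₂ min₀ _ cover

    minimum-size : ∀ {X} → MinimumVertexCover H X → ∣ X ∣ ≤ c
    minimum-size (_ , least′) = least′ X₀ (proj₁ min₀)

    large : ∀ {X} → VertexCover H X → Y ⊆ X → suc c ≤ ∣ X ∣
    large = blocked-cover-large H (proj₁ minimal-blocking) min₀

    cover-without : ∀ a → a ∈ Y → Σ (Subset (n H)) λ W → MinimumVertexCover H W × Y - a ⊆ W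
    cover-without a a∈Y = unblocked-cover H min₀ (Y - a)
      (proj₂ minimal-blocking (Y - a) (p─q⊆p Y ⁅ a ⁆ , a , a∈Y , ∉-minus Y))

    cover-size : ∀ X → VertexCover H′ X → suc (c + c) ≤ ∣ X ∣
    cover-size X cover with splitting X
    ... | split b X₁ X₂ with cover⁻ b X₁ X₂ cover
    ...   | cover₁ , cover₂ , inj₁ refl =
            subst (suc (c + c) ≤_) (sym (cong suc (∣++∣ X₁ X₂)))
                  (s≤s (+-mono-≤ (least cover₁) (least cover₂)))
    ...   | cover₁ , cover₂ , inj₂ (Y⊆X₁ , _) =
            ≤-trans (+-mono-≤ (large cover₁ Y⊆X₁) (least cover₂)) (∣split∣ b X₁ X₂)

    -- Hence a cover of H′ with 2c + 1 vertices is minimum; one is the apex with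
    -- a minimum cover of H in each copy.
    minimum-H′ : ∀ {X} → VertexCover H′ X → ∣ X ∣ ≤ suc (c + c) → MinimumVertexCover H′ X
    minimum-H′ = minimum-by-bound H′ cover-size

    apex-cover : VertexCover H′ (true ∷ (X₀ ++ X₀))
    apex-cover = cover⁺ true X₀ X₀ (proj₁ min₀) (proj₁ min₀) (inj₁ refl)

    -- A cover containing Y′ contains Y in the first copy and Y - y₀ in the
    -- second, so it has at least 2c + 2 vertices.
    Y′-blocking : Blocking H′ Y′
    Y′-blocking X (cover , least′) Y′⊆X with splitting X
    ... | split b X₁ X₂ with cover⁻ b X₁ X₂ cover
    ...   | cover₁ , cover₂ , apex-ok = 1+n≰n (≤-trans (too-large apex-ok) at-most)
      where
      Y⊆X₁ : Y ⊆ X₁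
      Y⊆X₁ u∈ = ∈₁⁻ (Y′⊆X (∈₁⁺ u∈))
      Y-y₀⊆X₂ : Y - y₀ ⊆ X₂
      Y-y₀⊆X₂ u∈ = ∈₂⁻ (Y′⊆X (∈₂⁺ u∈))
      at-most : ∣ b ∷ (X₁ ++ X₂) ∣ ≤ suc (c + c)
      at-most = ≤-trans (least′ _ apex-cover) (≤-reflexive (cong suc (∣++∣ X₀ X₀)))
      -- the second copy contains Y as soon as it contains y₀
      too-large : b ≡ true ⊎ Y ⊆ X₁ × y₀ ∈ X₂ → suc (suc (c + c)) ≤ ∣ b ∷ (X₁ ++ X₂) ∣
      too-large (inj₁ refl) = subst (suc (suc (c + c)) ≤_) (sym (cong suc (∣++∣ X₁ X₂)))
                                (s≤s (+-mono-≤ (large cover₁ Y⊆X₁) (least cover₂)))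
      too-large (inj₂ (_ , y₀∈X₂)) =
        ≤-trans (s≤s (≤-reflexive (sym (+-suc c c))))
                (≤-trans (+-mono-≤ (large cover₁ Y⊆X₁) (large cover₂ (add-back Y-y₀⊆X₂ y₀∈X₂)))
                         (∣split∣ b X₁ X₂))

    -- Y′ minus a vertex of the first copy: take the apex and, in the
    -- copies, minimum covers containing Y - a and Y - y₀.
    drop-first : ∀ a → a ∈ Y → Σ (Subset (n H′)) λ X →
                 MinimumVertexCover H′ X × (∀ z → z ∈ Y′ → z ≢ copy₁ a → z ∈ X)
    drop-first a a∈Y with cover-without a a∈Y | cover-without y₀ y₀∈Y
    ... | W₁ , min₁ , Y-a⊆W₁ | W₂ , min₂ , Y-y₀⊆W₂ =
      true ∷ (W₁ ++ W₂) , minimum-H′ cover small , λ z → contains (vertex z)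
      where
      cover : VertexCover H′ (true ∷ (W₁ ++ W₂))
      cover = cover⁺ true W₁ W₂ (proj₁ min₁) (proj₁ min₂) (inj₁ refl)
      small : ∣ true ∷ (W₁ ++ W₂) ∣ ≤ suc (c + c)
      small = subst (_≤ suc (c + c)) (sym (cong suc (∣++∣ W₁ W₂)))
                (s≤s (+-mono-≤ (minimum-size min₁) (minimum-size min₂)))
      contains : ∀ {z} → Vertex z → z ∈ Y′ → z ≢ copy₁ a → z ∈ true ∷ (W₁ ++ W₂)
      contains apex ()
      contains (first u) u∈ u≢a = ∈₁⁺ (Y-a⊆W₁ (x∈p∧x≢y⇒x∈p-y (∈₁⁻ u∈) λ { refl → u≢a refl }))
      contains (second u) u∈ _ = ∈₂⁺ (Y-y₀⊆W₂ (∈₂⁻ u∈))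

    -- Y′ minus a vertex a ≠ y₀ of the second copy: no apex; in the first
    -- copy a minimum cover W ⊇ Y - a together with a, in the second W itself.
    drop-second : ∀ a → a ∈ Y - y₀ → Σ (Subset (n H′)) λ X →
                  MinimumVertexCover H′ X × (∀ z → z ∈ Y′ → z ≢ copy₂ a → z ∈ X)
    drop-second a a∈ with cover-without a (p─q⊆p Y ⁅ y₀ ⁆ a∈)
    ... | W , minW , Y-a⊆W =
      false ∷ ((W ∪ ⁅ a ⁆) ++ W) , minimum-H′ cover small , λ z → contains (vertex z)
      where
      Y⊆W+a : Y ⊆ W ∪ ⁅ a ⁆
      Y⊆W+a = add-back (λ u∈ → p⊆p∪q ⁅ a ⁆ (Y-a⊆W u∈)) (x∈p∪q⁺ (inj₂ (x∈⁅x⁆ a)))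
      y₀∈W : y₀ ∈ W
      y₀∈W = Y-a⊆W (x∈p∧x≢y⇒x∈p-y y₀∈Y λ y₀≡a → ∈-minus⇒≢ Y a∈ (sym y₀≡a))
      cover : VertexCover H′ (false ∷ ((W ∪ ⁅ a ⁆) ++ W))
      cover = cover⁺ false (W ∪ ⁅ a ⁆) W (cover-⊆ H (p⊆p∪q ⁅ a ⁆) (proj₁ minW)) (proj₁ minW)
                     (inj₂ (Y⊆W+a , y₀∈W))
      small : ∣ false ∷ ((W ∪ ⁅ a ⁆) ++ W) ∣ ≤ suc (c + c)
      small = subst (_≤ suc (c + c)) (sym (∣++∣ (W ∪ ⁅ a ⁆) W))
                (+-mono-≤ (≤-trans (∣p∪⁅x⁆∣ W a) (s≤s (minimum-size minW))) (minimum-size minW))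
      contains : ∀ {z} → Vertex z → z ∈ Y′ → z ≢ copy₂ a → z ∈ false ∷ ((W ∪ ⁅ a ⁆) ++ W)
      contains apex ()
      contains (first u) u∈ _ = ∈₁⁺ (Y⊆W+a (∈₁⁻ u∈))
      contains (second u) u∈ u≢a =
        ∈₂⁺ (Y-a⊆W (x∈p∧x≢y⇒x∈p-y (p─q⊆p Y ⁅ y₀ ⁆ (∈₂⁻ u∈)) λ { refl → u≢a refl }))

    drop-vertex : ∀ {x} → Vertex x → x ∈ Y′ → Σ (Subset (n H′)) λ X →
                  MinimumVertexCover H′ X × (∀ z → z ∈ Y′ → z ≢ x → z ∈ X)
    drop-vertex apex ()
    drop-vertex (first a) a∈ = drop-first a (∈₁⁻ a∈)
    drop-vertex (second a) a∈ = drop-second a (∈₂⁻ a∈)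

    Y′-minimal : ∀ Y″ → Y″ ⊂ Y′ → ¬ Blocking H′ Y″
    Y′-minimal Y″ (Y″⊆Y′ , x , x∈Y′ , x∉Y″) blocking″ with drop-vertex (vertex x) x∈Y′
    ... | X , minX , contains =
      blocking″ X minX λ {z} z∈ → contains z (Y″⊆Y′ z∈) λ { refl → x∉Y″ z∈ }

lemma25 : (H : Graph) (Y : Subset (n H)) → MinimalBlocking H Y →
    Σ Graph λ H′ →
      (Σ (Subset (n H′)) λ Y′ → MinimalBlocking H′ Y′ × ∣ Y′ ∣ ≡ 2 * ∣ Y ∣ ∸ 1)
      × (∀ (𝒞 : GraphClass) → IsoClosed 𝒞 → Robust 𝒞 →
           ∀ k → EdLe 𝒞 k H → EdLe 𝒞 (suc k) H′)
lemma25 H Y minimal-blocking with nonempty? Y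
-- the empty set lies in every minimum cover, so it is not blocking
... | no empty = ⊥-elim (proj₁ minimal-blocking X₀ min₀ λ y∈Y → ⊥-elim (empty (_ , y∈Y)))
  where
  X₀ : Subset (n H)
  X₀ = proj₁ (minimum-cover H)
  min₀ : MinimumVertexCover H X₀
  min₀ = proj₂ (minimum-cover H)
... | yes (y₀ , y₀∈Y) =
  H′ , (Y′ , (Y′-blocking , Y′-minimal) , size-Y′ y₀∈Y) , λ 𝒞 iso robust k → ed-H′ 𝒞 iso robust
  where
  open Doubling H Y y₀
  open Covers minimal-blocking y₀∈Y
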